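{- Let $S\subseteq\mathbb{F}_2^n$ and $s=|S|$. If $s>1$ and the affine dimension of $S$ is equal to $n$, then $\mathcal{L}(S)\le s-2$.
   Context: A subset $\{x_1,\dots,x_m\}$ of $\mathbb{F}_2^n$ is affinely independent if no $x_i$ lies in the affine span (the set of sums of an odd number of elements) of the others; $S$ has affine dimension $d$ if $d+1$ is the largest size of an affinely independent subset of $S$. $\widehat{1_S}(a)=\sum_{x\in S}(-1)^{x\cdot a}$ and $\mathcal{L}(S)=\max_{a\in\mathbb{F}_2^n\setminus\{0\}}|\widehat{1_S}(a)|$. -}

module Defs where

open import Data.Bool using (Bool; true; false; _xor_; _∧_; if_then_else_)
open import Data.Nat using (ℕ; zero; suc; _≤_)
open import Data.Integer using (ℤ; +_; -_; _+_)
open import Data.Vec using (Vec; zipWith; foldr; replicate)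
open import Data.List using (List; []; _∷_; length; removeAt; lookup)
open import Data.List.Relation.Unary.All using (All)
open import Data.List.Relation.Unary.Unique.Propositional using (Unique)
open import Data.List.Membership.Propositional using (_∈_)
open import Data.List.Relation.Binary.Sublist.Propositional using (_⊆_)
open import Data.Product using (Σ; _×_; ∃)
open import Relation.Binary.PropositionalEquality using (_≡_)
open import Relation.Nullary using (¬_)
open import Data.Empty using (⊥)
open import Data.Unit using (⊤)

-- The vector space F₂ⁿ, with F₂ = Bool (false = 0, true = 1, addition = xor).
F₂^ : ℕ → Set
F₂^ n = Vec Bool n

0v : ∀ {n} → F₂^ n
0v {n} = replicate n false

_⊕_ : ∀ {n} → F₂^ n → F₂^ n → F₂^ n
_⊕_ = zipWith _xor_

_·_ : ∀ {n} → F₂^ n → F₂^ n → Bool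
x · a = foldr (λ _ → Bool) _xor_ false (zipWith _∧_ x a)

vsum : ∀ {n} → List (F₂^ n) → F₂^ n
vsum [] = 0v
vsum (x ∷ xs) = x ⊕ vsum xs

Odd : ℕ → Set
Odd zero = ⊥
Odd (suc zero) = ⊤
Odd (suc (suc k)) = Odd k

-- affine span of a (list of) points: sums of an odd number of (distinct
-- positions of) elements of T
InAffSpan : ∀ {n} → F₂^ n → List (F₂^ n) → Set
InAffSpan x T = Σ (List _) λ ys → ys ⊆ T × Odd (length ys) × vsum ys ≡ x

AffIndep : ∀ {n} → List (F₂^ n) → Set
AffIndep xs = Unique xs × (∀ i → ¬ InAffSpan (lookup xs i) (removeAt xs i))

_⊆S_ : ∀ {n} → List (F₂^ n) → List (F₂^ n) → Set
ys ⊆S S = All (_∈ S) ys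

AffDim : ∀ {n} → List (F₂^ n) → ℕ → Set
AffDim S d =
  (Σ (List _) λ xs → xs ⊆S S × AffIndep xs × length xs ≡ suc d)
  × (∀ xs → xs ⊆S S → AffIndep xs → length xs ≤ suc d)

fourier : ∀ {n} → List (F₂^ n) → F₂^ n → ℤ
fourier [] a = + 0
fourier (x ∷ S) a = (if x · a then - (+ 1) else + 1) + fourier S a

{-# OPTIONS --safe #-}
module Submission where

-- Write s₀ and s₁ for the numbers of x ∈ S with x·a = 0 and x·a = 1. Then
-- 1̂_S(a) = s₀ − s₁ and s = s₀ + s₁, so |1̂_S(a)| ≤ s − 2 as soon as s₀ and s₁ are
-- both positive. Otherwise S lies in an affine hyperplane x·a = c, which cannot
-- contain n + 1 affinely independent points x₀, …, xₙ: if aⱼ = 1, deleting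
-- coordinate j is injective on the direction space a^⊥, so the n differences
-- x₀ ⊕ xᵢ ∈ a^⊥ have a nonempty zero subsum (n vectors of F₂^(n−1)), and such a
-- subsum is an affine relation among the xᵢ.

open import Defs
open import Data.Nat using (ℕ; _<_; _≤_; _∸_; zero; suc; _+_; _⊔_; s≤s; z<s)
open import Data.Integer using (∣_∣)
open import Data.List using (List; length; []; _∷_; map)
open import Data.List.Relation.Unary.Unique.Propositional using (Unique)
open import Relation.Binary.PropositionalEquality
  using (_≡_; _≢_; refl; sym; trans; cong; cong₂; module ≡-Reasoning)
open import Relation.Nullary using (¬_; yes; no; contradiction)

open import Algebra.Bundles using (CommutativeRing)
open import Data.Bool using (Bool; true; false; not; _∧_; _xor_; if_then_else_)
open import Data.Bool.Properties
  using ( _≟_; xor-assoc; xor-identityˡ; xor-identityʳ; xor-same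
        ; ∧-identityʳ; ∧-distribʳ-xor; not-involutive; not-injective; ¬-not
        ; xor-∧-commutativeRing)
open import Data.Empty using (⊥-elim)
open import Data.Fin using (Fin; zero; suc)
import Data.Integer as ℤ
open import Data.Integer.Properties
  using ([1+m]⊖[1+n]≡m⊖n; ∣m⊝n∣≤m⊔n; distribʳ-⊖-+-pos; distribʳ-⊖-+-neg)
import Data.List as List
open import Data.List.Properties using (map-id)
open import Data.List.Relation.Binary.Sublist.Propositional using (_⊆_; _∷_; _∷ʳ_; minimum)
open import Data.List.Relation.Binary.Sublist.Propositional.Properties using (All-resp-⊆)
open import Data.List.Relation.Unary.All as All using (All; []; _∷_)
open import Data.List.Relation.Unary.All.Properties.Core using (¬Any⇒All¬)
open import Data.List.Relation.Unary.Any as Any using (Any; here; there; any?)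
open import Data.Nat.Properties using (≤-reflexive; m⊔n≤m+n; +-suc; module ≤-Reasoning)
open import Data.Product using (∃; _×_; _,_; proj₁; proj₂)
open import Data.Sum using (_⊎_; inj₁; inj₂; fromInj₂)
open import Data.Unit using (tt)
open import Data.Vec using ([]; _∷_; lookup; removeAt)
open import Data.Vec.Properties using (lookup-zipWith; lookup-replicate; ∷-injectiveˡ; ∷-injectiveʳ)
open import Data.Vec.Relation.Binary.Pointwise.Inductive
  using (Pointwise-≡⇒≡; zipWith-assoc; zipWith-identityˡ; zipWith-identityʳ)
open import Function using (_∘_; id)

open import Algebra.Properties.CommutativeSemigroup
  (CommutativeRing.+-commutativeSemigroup xor-∧-commutativeRing)
  using () renaming (interchange to xor-interchange; x∙yz≈y∙xz to xor-left-comm)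

⊕-assoc : ∀ {n} (x y z : F₂^ n) → (x ⊕ y) ⊕ z ≡ x ⊕ (y ⊕ z)
⊕-assoc x y z = Pointwise-≡⇒≡ (zipWith-assoc xor-assoc x y z)

⊕-identityˡ : ∀ {n} (x : F₂^ n) → 0v ⊕ x ≡ x
⊕-identityˡ x = Pointwise-≡⇒≡ (zipWith-identityˡ xor-identityˡ x)

⊕-identityʳ : ∀ {n} (x : F₂^ n) → x ⊕ 0v ≡ x
⊕-identityʳ x = Pointwise-≡⇒≡ (zipWith-identityʳ xor-identityʳ x)

⊕-self : ∀ {n} (x : F₂^ n) → x ⊕ x ≡ 0v
⊕-self []      = refl
⊕-self (b ∷ x) = cong₂ _∷_ (xor-same b) (⊕-self x)

⊕-interchange : ∀ {n} (w x y z : F₂^ n) → (w ⊕ x) ⊕ (y ⊕ z) ≡ (w ⊕ y) ⊕ (x ⊕ z)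
⊕-interchange []      []      []      []      = refl
⊕-interchange (a ∷ w) (b ∷ x) (c ∷ y) (d ∷ z) =
  cong₂ _∷_ (xor-interchange a b c d) (⊕-interchange w x y z)

⊕≡0v⇒≡ : ∀ {n} {x y : F₂^ n} → x ⊕ y ≡ 0v → x ≡ y
⊕≡0v⇒≡ {x = x} {y} x⊕y≡0 = begin
  x            ≡⟨ ⊕-identityʳ x ⟨
  x ⊕ 0v       ≡⟨ cong (x ⊕_) (⊕-self y) ⟨
  x ⊕ (y ⊕ y)  ≡⟨ ⊕-assoc x y y ⟨
  (x ⊕ y) ⊕ y  ≡⟨ cong (_⊕ y) x⊕y≡0 ⟩
  0v ⊕ y       ≡⟨ ⊕-identityˡ y ⟩
  y            ∎
  where open ≡-Reasoning

F₂^0-trivial : (x : F₂^ 0) → x ≡ 0v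
F₂^0-trivial [] = refl

_•_ : ∀ {n} → Bool → F₂^ n → F₂^ n
b • v = if b then v else 0v

•-distribʳ-xor : ∀ {n} b c (v : F₂^ n) → (b • v) ⊕ (c • v) ≡ (b xor c) • v
•-distribʳ-xor true  true  v = ⊕-self v
•-distribʳ-xor true  false v = ⊕-identityʳ v
•-distribʳ-xor false c     v = ⊕-identityˡ (c • v)

·-distribʳ-⊕ : ∀ {n} (x y a : F₂^ n) → (x ⊕ y) · a ≡ (x · a) xor (y · a)
·-distribʳ-⊕ []       []       []       = refl
·-distribʳ-⊕ (x ∷ xs) (y ∷ ys) (a ∷ as) = begin
  ((x xor y) ∧ a) xor ((xs ⊕ ys) · as)
    ≡⟨ cong₂ _xor_ (∧-distribʳ-xor a x y) (·-distribʳ-⊕ xs ys as) ⟩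
  ((x ∧ a) xor (y ∧ a)) xor ((xs · as) xor (ys · as))
    ≡⟨ xor-interchange (x ∧ a) (y ∧ a) (xs · as) (ys · as) ⟩
  ((x ∧ a) xor (xs · as)) xor ((y ∧ a) xor (ys · as))
    ∎
  where open ≡-Reasoning

·-zeroˡ : ∀ {n} (a : F₂^ n) → 0v · a ≡ false
·-zeroˡ []       = refl
·-zeroˡ (_ ∷ as) = ·-zeroˡ as

≡0v⊎pivot : ∀ {n} (v : F₂^ n) → v ≡ 0v ⊎ ∃ λ j → lookup v j ≡ true
≡0v⊎pivot []          = inj₁ refl
≡0v⊎pivot (true ∷ v)  = inj₂ (zero , refl)
≡0v⊎pivot (false ∷ v) with ≡0v⊎pivot v
... | inj₁ v≡0        = inj₁ (cong (false ∷_) v≡0)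
... | inj₂ (j , vⱼ≡1) = inj₂ (suc j , vⱼ≡1)

lookup-• : ∀ {n} b {v : F₂^ n} {j} → lookup v j ≡ true → lookup (b • v) j ≡ b
lookup-• true            vⱼ≡1 = vⱼ≡1
lookup-• false {j = j} _    = lookup-replicate j false

removeAt-⊕ : ∀ {n} (x y : F₂^ (suc n)) j →
             removeAt (x ⊕ y) j ≡ removeAt x j ⊕ removeAt y j
removeAt-⊕ (_ ∷ _)          (_ ∷ _)          zero    = refl
removeAt-⊕ (a ∷ x@(_ ∷ _)) (b ∷ y@(_ ∷ _)) (suc j) = cong ((a xor b) ∷_) (removeAt-⊕ x y j)

removeAt-0v : ∀ {n} (j : Fin (suc n)) → removeAt 0v j ≡ 0v
removeAt-0v zero            = refl
removeAt-0v {suc n} (suc j) = cong (false ∷_) (removeAt-0v j)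

·-removeAt : ∀ {n} (x a : F₂^ (suc n)) j →
             x · a ≡ (lookup x j ∧ lookup a j) xor (removeAt x j · removeAt a j)
·-removeAt (_ ∷ _)           (_ ∷ _)           zero    = refl
·-removeAt (x ∷ xs@(_ ∷ _)) (a ∷ as@(_ ∷ _)) (suc j) =
  trans (cong ((x ∧ a) xor_) (·-removeAt xs as j))
        (xor-left-comm (x ∧ a) (lookup xs j ∧ lookup as j) (removeAt xs j · removeAt as j))

≡0v-removeAt : ∀ {n} (v : F₂^ (suc n)) j →
               lookup v j ≡ false → removeAt v j ≡ 0v → v ≡ 0v
≡0v-removeAt (_ ∷ _)          zero    vⱼ≡0 v′≡0 = cong₂ _∷_ vⱼ≡0 v′≡0
≡0v-removeAt (b ∷ v@(_ ∷ _)) (suc j) vⱼ≡0 v′≡0 =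
  cong₂ _∷_ (∷-injectiveˡ v′≡0) (≡0v-removeAt v j vⱼ≡0 (∷-injectiveʳ v′≡0))

≡0v-removeAt-orthogonal : ∀ {n} {a : F₂^ (suc n)} {j} → lookup a j ≡ true →
                          (z : F₂^ (suc n)) → z · a ≡ false → removeAt z j ≡ 0v → z ≡ 0v
≡0v-removeAt-orthogonal {a = a} {j} aⱼ≡1 z z·a≡0 z′≡0 = ≡0v-removeAt z j zⱼ≡0 z′≡0
  where
  open ≡-Reasoning

  zⱼ≡0 : lookup z j ≡ false
  zⱼ≡0 = begin
    lookup z j                         ≡⟨ ∧-identityʳ _ ⟨
    lookup z j ∧ true                  ≡⟨ xor-identityʳ _ ⟨
    (lookup z j ∧ true) xor false
      ≡⟨ cong₂ (λ aⱼ r → (lookup z j ∧ aⱼ) xor r) aⱼ≡1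
               (trans (cong (_· removeAt a j) z′≡0) (·-zeroˡ (removeAt a j))) ⟨
    (lookup z j ∧ lookup a j) xor (removeAt z j · removeAt a j)
      ≡⟨ ·-removeAt z a j ⟨
    z · a                                  ≡⟨ z·a≡0 ⟩
    false                                  ∎

xorSum : ∀ {B : Set} → (B → Bool) → List B → Bool
xorSum b []       = false
xorSum b (u ∷ us) = b u xor xorSum b us

parity : ∀ {B : Set} → List B → Bool
parity = xorSum (λ _ → true)

parity≡true⇒Odd : ∀ {B : Set} (us : List B) → parity us ≡ true → Odd (length us)
parity≡true⇒Odd (_ ∷ [])     _ = tt
parity≡true⇒Odd (_ ∷ _ ∷ us) p = parity≡true⇒Odd us (trans (sym (not-involutive (parity us))) p)

xorSum-false : ∀ {B : Set} {b : B → Bool} {us} → All (λ u → b u ≡ false) us → xorSum b us ≡ false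
xorSum-false []             = refl
xorSum-false (bu≡0 ∷ bus≡0) = cong₂ _xor_ bu≡0 (xorSum-false bus≡0)

vsum-map-⊕ : ∀ {B : Set} {n} (f g : B → F₂^ n) us →
             vsum (map (λ u → f u ⊕ g u) us) ≡ vsum (map f us) ⊕ vsum (map g us)
vsum-map-⊕ f g []       = sym (⊕-self 0v)
vsum-map-⊕ f g (u ∷ us) = trans (cong ((f u ⊕ g u) ⊕_) (vsum-map-⊕ f g us))
                                (⊕-interchange (f u) (g u) _ _)

vsum-map-• : ∀ {B : Set} {n} (b : B → Bool) (v : F₂^ n) us →
             vsum (map (λ u → b u • v) us) ≡ xorSum b us • v
vsum-map-• b v []       = refl
vsum-map-• b v (u ∷ us) = trans (cong ((b u • v) ⊕_) (vsum-map-• b v us))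
                                (•-distribʳ-xor (b u) (xorSum b us) v)

linear-vsum : ∀ {B : Set} {n} (φ : F₂^ n → Bool) →
              (∀ x y → φ (x ⊕ y) ≡ φ x xor φ y) → φ 0v ≡ false →
              ∀ (h : B → F₂^ n) us → φ (vsum (map h us)) ≡ xorSum (φ ∘ h) us
linear-vsum φ φ-⊕ φ-0v h []       = φ-0v
linear-vsum φ φ-⊕ φ-0v h (u ∷ us) =
  trans (φ-⊕ (h u) _) (cong (φ (h u) xor_) (linear-vsum φ φ-⊕ φ-0v h us))

removeAt-vsum : ∀ {B : Set} {n} (h : B → F₂^ (suc n)) j us →
                removeAt (vsum (map h us)) j ≡ vsum (map (λ u → removeAt (h u) j) us)
removeAt-vsum h j []       = removeAt-0v j
removeAt-vsum h j (u ∷ us) = trans (removeAt-⊕ (h u) _ j) (cong (_ ⊕_) (removeAt-vsum h j us))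

record ZeroSubsum {B : Set} {n} (f : B → F₂^ n) (ws : List B) : Set where
  constructor zeroSubsum
  field
    u       : B
    us      : List B
    sublist : u ∷ us ⊆ ws
    sum≡0v  : vsum (map f (u ∷ us)) ≡ 0v

-- Gaussian elimination: adding f w to every f x with a 1 at a pivot coordinate j
-- of f w clears coordinate j, so deleting it loses nothing and the induction
-- hypothesis applies.
linearDependence : ∀ n {B : Set} (f : B → F₂^ n) (ws : List B) → n < length ws → ZeroSubsum f ws
linearDependence zero    f (w ∷ ws) _ = zeroSubsum w [] (refl ∷ minimum ws) (F₂^0-trivial _)
linearDependence (suc n) {B} f (w ∷ ws) (s≤s n<|ws|) with ≡0v⊎pivot (f w)
... | inj₁ fw≡0 = zeroSubsum w [] (refl ∷ minimum ws) (trans (⊕-identityʳ (f w)) fw≡0)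
... | inj₂ (j , fwⱼ≡1) = close (xorSum b (u ∷ us)) Σf≡
  where
  open ≡-Reasoning

  b : B → Bool
  b x = lookup (f x) j

  reduce : B → F₂^ (suc n)
  reduce x = f x ⊕ (b x • f w)

  open ZeroSubsum (linearDependence n (λ x → removeAt (reduce x) j) ws n<|ws|)

  reduceⱼ≡0 : ∀ x → lookup (reduce x) j ≡ false
  reduceⱼ≡0 x = begin
    lookup (reduce x) j          ≡⟨ lookup-zipWith _xor_ j (f x) (b x • f w) ⟩
    b x xor lookup (b x • f w) j ≡⟨ cong (b x xor_) (lookup-• (b x) fwⱼ≡1) ⟩
    b x xor b x                      ≡⟨ xor-same (b x) ⟩
    false                            ∎

  Σreduce≡0 : vsum (map reduce (u ∷ us)) ≡ 0v
  Σreduce≡0 = ≡0v-removeAt _ j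
    (trans (linear-vsum (λ v → lookup v j) (lookup-zipWith _xor_ j) (lookup-replicate j false)
                        reduce (u ∷ us))
           (xorSum-false (All.universal reduceⱼ≡0 (u ∷ us))))
    (trans (removeAt-vsum reduce j (u ∷ us)) sum≡0v)

  Σf≡ : vsum (map f (u ∷ us)) ≡ xorSum b (u ∷ us) • f w
  Σf≡ = ⊕≡0v⇒≡ (begin
    vsum (map f (u ∷ us)) ⊕ (xorSum b (u ∷ us) • f w)
      ≡⟨ cong (vsum (map f (u ∷ us)) ⊕_) (vsum-map-• b (f w) (u ∷ us)) ⟨
    vsum (map f (u ∷ us)) ⊕ vsum (map (λ x → b x • f w) (u ∷ us))
      ≡⟨ vsum-map-⊕ f (λ x → b x • f w) (u ∷ us) ⟨
    vsum (map reduce (u ∷ us))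
      ≡⟨ Σreduce≡0 ⟩
    0v ∎)

  close : ∀ c → vsum (map f (u ∷ us)) ≡ c • f w → ZeroSubsum f (w ∷ ws)
  close false Σf≡0  = zeroSubsum u us (w ∷ʳ sublist) Σf≡0
  close true  Σf≡fw = zeroSubsum w (u ∷ us) (refl ∷ sublist)
                                 (trans (cong (f w ⊕_) Σf≡fw) (⊕-self (f w)))

∷⊆⇒lookup-removeAt : ∀ {A : Set} {y : A} {ys xs} → y ∷ ys ⊆ xs →
                     ∃ λ i → List.lookup xs i ≡ y × ys ⊆ List.removeAt xs i
∷⊆⇒lookup-removeAt (x ∷ʳ y∷ys⊆xs) with ∷⊆⇒lookup-removeAt y∷ys⊆xs
... | i , xsᵢ≡y , ys⊆xs∖i = suc i , xsᵢ≡y , x ∷ʳ ys⊆xs∖i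
∷⊆⇒lookup-removeAt (refl ∷ ys⊆xs) = zero , refl , ys⊆xs

affineRelation⇒¬AffIndep : ∀ {n} {y : F₂^ n} {ys xs} →
                           y ∷ ys ⊆ xs → Odd (length ys) → vsum ys ≡ y → ¬ AffIndep xs
affineRelation⇒¬AffIndep y∷ys⊆xs odd Σys≡y (_ , indep) with ∷⊆⇒lookup-removeAt y∷ys⊆xs
... | i , xsᵢ≡y , ys⊆xs∖i = indep i (_ , ys⊆xs∖i , odd , trans Σys≡y (sym xsᵢ≡y))

zeroDifferenceSum⇒¬AffIndep : ∀ {n} {x₀ : F₂^ n} {xs} → ZeroSubsum (x₀ ⊕_) xs → ¬ AffIndep (x₀ ∷ xs)
zeroDifferenceSum⇒¬AffIndep {x₀ = x₀} {xs} (zeroSubsum u us u∷us⊆xs Σ≡0) =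
  close (parity (u ∷ us)) refl parity•x₀≡Σ
  where
  open ≡-Reasoning

  parity•x₀≡Σ : parity (u ∷ us) • x₀ ≡ vsum (u ∷ us)
  parity•x₀≡Σ = ⊕≡0v⇒≡ (begin
    (parity (u ∷ us) • x₀) ⊕ vsum (u ∷ us)
      ≡⟨ cong₂ _⊕_ (vsum-map-• (λ _ → true) x₀ (u ∷ us)) (cong vsum (map-id (u ∷ us))) ⟨
    vsum (map (λ _ → x₀) (u ∷ us)) ⊕ vsum (map id (u ∷ us))
      ≡⟨ vsum-map-⊕ (λ _ → x₀) id (u ∷ us) ⟨
    vsum (map (x₀ ⊕_) (u ∷ us))
      ≡⟨ Σ≡0 ⟩
    0v ∎)

  close : ∀ p → parity (u ∷ us) ≡ p → p • x₀ ≡ vsum (u ∷ us) → ¬ AffIndep (x₀ ∷ xs)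
  close true  odd x₀≡Σ =
    affineRelation⇒¬AffIndep (refl ∷ u∷us⊆xs) (parity≡true⇒Odd (u ∷ us) odd) (sym x₀≡Σ)
  close false even 0≡Σ =
    affineRelation⇒¬AffIndep (x₀ ∷ʳ u∷us⊆xs) (parity≡true⇒Odd us (not-injective {y = true} even))
                             (sym (⊕≡0v⇒≡ (sym 0≡Σ)))

hyperplane-¬AffIndep : ∀ {m} {a : F₂^ (suc m)} → a ≢ 0v → ∀ c xs →
                       suc m < length xs → All (λ x → x · a ≡ c) xs → ¬ AffIndep xs
hyperplane-¬AffIndep {m} {a} a≢0 c (x₀ ∷ xs) (s≤s m<|xs|) (x₀·a≡c ∷ xs·a≡c) =
  zeroDifferenceSum⇒¬AffIndep (zeroSubsum u us sublist Σ≡0)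
  where
  pivot : ∃ λ j → lookup a j ≡ true
  pivot = fromInj₂ (λ a≡0 → contradiction a≡0 a≢0) (≡0v⊎pivot a)

  open ZeroSubsum (linearDependence m (λ x → removeAt (x₀ ⊕ x) (proj₁ pivot)) xs m<|xs|)

  differences⊥a : All (λ x → (x₀ ⊕ x) · a ≡ false) (u ∷ us)
  differences⊥a = All.map (λ {x} x·a≡c → trans (·-distribʳ-⊕ x₀ x a)
                                              (trans (cong₂ _xor_ x₀·a≡c x·a≡c) (xor-same c)))
                          (All-resp-⊆ sublist xs·a≡c)

  Σ≡0 : vsum (map (x₀ ⊕_) (u ∷ us)) ≡ 0v
  Σ≡0 = ≡0v-removeAt-orthogonal (proj₂ pivot) _
    (trans (linear-vsum (_· a) (λ x y → ·-distribʳ-⊕ x y a) (·-zeroˡ a) (x₀ ⊕_) (u ∷ us))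
           (xorSum-false differences⊥a))
    (trans (removeAt-vsum (x₀ ⊕_) (proj₁ pivot) (u ∷ us)) sum≡0v)

count : ∀ {A : Set} → (A → Bool) → List A → ℕ
count p []       = 0
count p (x ∷ xs) = if p x then suc (count p xs) else count p xs

count-pos : ∀ {A : Set} {p : A → Bool} {xs} → Any (λ x → p x ≡ true) xs → 0 < count p xs
count-pos {xs = _ ∷ _} (here px≡1) rewrite px≡1 = z<s
count-pos {p = p} {x ∷ _} (there any) with p x
... | true  = z<s
... | false = count-pos any

length≡count+count : ∀ {A : Set} (p : A → Bool) xs → length xs ≡ count (not ∘ p) xs + count p xs
length≡count+count p []       = refl
length≡count+count p (x ∷ xs) with p x
... | true  = trans (cong suc (length≡count+count p xs)) (sym (+-suc _ _))
... | false = cong suc (length≡count+count p xs)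

fourier≡count⊖count : ∀ {n} (S : List (F₂^ n)) a →
                      fourier S a ≡ count (not ∘ (_· a)) S ℤ.⊖ count (_· a) S
fourier≡count⊖count []      a = refl
fourier≡count⊖count (x ∷ S) a with x · a
... | true  = trans (cong (ℤ._+_ ℤ.-[1+ 0 ]) (fourier≡count⊖count S a))
                    (distribʳ-⊖-+-neg 0 _ (count _ S))
... | false = trans (cong (ℤ._+_ (ℤ.+ 1)) (fourier≡count⊖count S a))
                    (distribʳ-⊖-+-pos 1 _ (count _ S))

∣m⊖n∣≤m+n∸2 : ∀ {m n} → 0 < m → 0 < n → ∣ m ℤ.⊖ n ∣ ≤ m + n ∸ 2
∣m⊖n∣≤m+n∸2 {suc m} {suc n} _ _ = begin
  ∣ suc m ℤ.⊖ suc n ∣  ≡⟨ cong ∣_∣ ([1+m]⊖[1+n]≡m⊖n m n) ⟩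
  ∣ m ℤ.⊖ n ∣          ≤⟨ ∣m⊝n∣≤m⊔n m n ⟩
  m ⊔ n                ≤⟨ m⊔n≤m+n m n ⟩
  m + n                ≡⟨ cong (_∸ 1) (+-suc m n) ⟨
  m + suc n ∸ 1        ∎
  where open ≤-Reasoning

∣fourier∣≤length∸2 : ∀ {n} {a : F₂^ n} {S} →
                     Any (λ x → x · a ≡ false) S → Any (λ x → x · a ≡ true) S →
                     ∣ fourier S a ∣ ≤ length S ∸ 2
∣fourier∣≤length∸2 {a = a} {S} some0 some1 = begin
  ∣ fourier S a ∣
    ≡⟨ cong ∣_∣ (fourier≡count⊖count S a) ⟩
  ∣ count (not ∘ (_· a)) S ℤ.⊖ count (_· a) S ∣
    ≤⟨ ∣m⊖n∣≤m+n∸2 (count-pos (Any.map (cong not) some0)) (count-pos some1) ⟩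
  count (not ∘ (_· a)) S + count (_· a) S ∸ 2
    ≡⟨ cong (_∸ 2) (length≡count+count (_· a) S) ⟨
  length S ∸ 2
    ∎
  where open ≤-Reasoning

constant⊎both : ∀ {A : Set} (p : A → Bool) xs →
                (∃ λ c → All (λ x → p x ≡ c) xs) ⊎
                (Any (λ x → p x ≡ false) xs × Any (λ x → p x ≡ true) xs)
constant⊎both p xs with any? (λ x → p x ≟ false) xs | any? (λ x → p x ≟ true) xs
... | yes some0 | yes some1 = inj₂ (some0 , some1)
... | no none0  | _         = inj₁ (true , All.map ¬-not (¬Any⇒All¬ xs none0))
... | yes _     | no none1  = inj₁ (false , All.map ¬-not (¬Any⇒All¬ xs none1))

proposition3p6 : (n : ℕ) (S : List (F₂^ n)) → Unique S → 1 < length S → AffDim S n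
    → (a : F₂^ n) → ¬ (a ≡ 0v) → ∣ fourier S a ∣ ≤ length S ∸ 2
proposition3p6 zero    S _ _ _ [] []≢0 = ⊥-elim ([]≢0 refl)
proposition3p6 (suc m) S _ _ ((xs , xs⊆S , xs-indep , |xs|≡) , _) a a≢0 with constant⊎both (_· a) S
... | inj₂ (some0 , some1)    = ∣fourier∣≤length∸2 some0 some1
... | inj₁ (c , S⊆hyperplane) =
  ⊥-elim (hyperplane-¬AffIndep a≢0 c xs (≤-reflexive (sym |xs|≡))
                               (All.map (All.lookup S⊆hyperplane) xs⊆S) xs-indep)
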